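{- Let $D=(V,A)$ be a directed acyclic graph with vertices $s,t$, let $d,q,r$ be non-negative integers, and fix $P\in\mathcal P(s,t)$. Let $P^*_1,\dots,P^*_r\in\mathcal P(s,t)$ satisfy $|P\triangle P^*_i|\le q$ for $1\le i\le r$ and $|P^*_i\triangle P^*_j|\ge d$ for $1\le i<j\le r$. Let $B^*_i = P\triangle P^*_i$ and $B^*=\bigcup_{i=1}^r B^*_i$. Let $f\colon A\to[qr]$ be a function with $f(e)\neq f(e')$ for all distinct $e,e'\in B^*$, and put $C^*_i = f(B^*_i)$. Then $|C^*_i \triangle C^*_j| \ge d$ for all $1 \le i < j \le r$.
   Context: $\mathcal P(s,t)$ denotes the set of all directed paths from $s$ to $t$ in $D$. Paths are identified with their arc sets, so $\triangle$ is symmetric difference of arc sets. $[m]=\{1,\dots,m\}$. For $X\subseteq A$, $f(X)=\{f(e):e\in X\}$. -}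

module Defs where

open import Data.Nat using (ℕ; zero; suc)
open import Data.Bool using (Bool; true; false; _xor_)
open import Data.Fin using (Fin; zero; suc; inject₁; fromℕ; _≟_)
open import Data.Fin.Subset using (Subset; _∈_)
open import Data.Fin.Subset.Properties using (_∈?_)
open import Data.Fin.Properties using (any?)
open import Data.Vec using (zipWith; tabulate)
open import Data.Product using (Σ; ∃; _×_; _,_)
open import Relation.Nullary using (¬_; does)
open import Relation.Nullary.Decidable using (_×-dec_)
open import Relation.Binary.PropositionalEquality using (_≡_; _≢_)
open import Function.Bundles using (_⇔_)

-- A (finite) directed graph D = (V, A): vertices Fin n, arcs Fin m,
-- each arc e goes from tail e to head e.  No parallel arcs (A ⊆ V × V).
record Digraph : Set where
  field
    nV   : ℕ
    nA   : ℕ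
    tail : Fin nA → Fin nV
    head : Fin nA → Fin nV
    simple : ∀ e e' → tail e ≡ tail e' → head e ≡ head e' → e ≡ e'

open Digraph public

ArcSet : Digraph → Set
ArcSet D = Subset (nA D)

Acyclic : Digraph → Set
Acyclic D = ∀ (k : ℕ) (es : Fin (suc k) → Fin (nA D)) →
  (∀ (i : Fin k) → head D (es (inject₁ i)) ≡ tail D (es (suc i))) →
  head D (es (fromℕ k)) ≢ tail D (es zero)

IsPath : (D : Digraph) → Fin (nV D) → Fin (nV D) → ArcSet D → Set
IsPath D s t X =
  Σ ℕ λ k → Σ (Fin (suc k) → Fin (nV D)) λ vs → Σ (Fin k → Fin (nA D)) λ es →
    (∀ i j → vs i ≡ vs j → i ≡ j) ×
    vs zero ≡ s × vs (fromℕ k) ≡ t ×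
    (∀ i → tail D (es i) ≡ vs (inject₁ i)) ×
    (∀ i → head D (es i) ≡ vs (suc i)) ×
    (∀ e → (e ∈ X) ⇔ (∃ λ i → es i ≡ e))

_△_ : ∀ {m} → Subset m → Subset m → Subset m
X △ Y = zipWith _xor_ X Y

image : ∀ {m k} → (Fin m → Fin k) → Subset m → Subset k
image f X = tabulate λ j → does (any? λ e → (e ∈? X) ×-dec (f e ≟ j))

{-# OPTIONS --safe #-}
module Submission where

open import Defs
open import Data.Bool using (true; false; _xor_; _∨_)
open import Data.Bool.Properties using (xor-annihilates-not)
open import Data.Nat using (ℕ; _*_; _≤_; z≤n; s≤s)
open import Data.Nat.Properties using (≤-trans; module ≤-Reasoning)
open import Data.Fin using (Fin; _<_; zero; suc; _≟_)
open import Data.Fin.Properties using (any?; suc-injective; 0≢1+n)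
open import Data.Fin.Subset using (Subset; ∣_∣; _∈_; _⊆_; _∪_; _-_; inside; outside)
open import Data.Fin.Subset.Properties
  using (_∈?_; p⊆p∪q; q⊆p∪q; x∈p∪q⁻; x∈p∧x≢y⇒x∈p-y; x∈p⇒∣p-x∣<∣p∣)
open import Data.Vec using (_∷_; []; lookup; here; there)
open import Data.Vec.Properties using (lookup-zipWith; lookup∘tabulate; []=⇒lookup; lookup⇒[]=)
open import Data.Product using (∃; _×_; _,_)
open import Data.Sum using ([_,_]′)
open import Function.Bundles using (_⇔_; mk⇔)
open import Relation.Nullary using (does)
open import Relation.Nullary.Decidable using (_×-dec_; does-⇔; decidable-stable)
open import Relation.Binary.PropositionalEquality using (_≡_; _≢_; refl; sym; trans; cong; cong₂; subst; module ≡-Reasoning)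

-- Writing B_i = P △ P*_i, we have P*_i △ P*_j = B_i △ B_j, and f, being injective on
-- B_i ∪ B_j, maps B_i △ B_j injectively into f(B_i) △ f(B_j).

InjectiveOn : ∀ {m k} → (Fin m → Fin k) → Subset m → Set
InjectiveOn f p = ∀ {x y} → x ∈ p → y ∈ p → f x ≡ f y → x ≡ y

injectiveOn-⊆ : ∀ {m k} {f : Fin m → Fin k} {p q : Subset m} →
  p ⊆ q → InjectiveOn f q → InjectiveOn f p
injectiveOn-⊆ p⊆q inj x∈p y∈p = inj (p⊆q x∈p) (p⊆q y∈p)

injectiveOn⇒∣p∣≤∣q∣ : ∀ {m k} {f : Fin m → Fin k} (p : Subset m) {q : Subset k} →
  (∀ {x} → x ∈ p → f x ∈ q) → InjectiveOn f p → ∣ p ∣ ≤ ∣ q ∣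
injectiveOn⇒∣p∣≤∣q∣ [] maps inj = z≤n
injectiveOn⇒∣p∣≤∣q∣ (outside ∷ p) maps inj =
  injectiveOn⇒∣p∣≤∣q∣ p (λ x∈p → maps (there x∈p))
    (λ x∈p y∈p eq → suc-injective (inj (there x∈p) (there y∈p) eq))
injectiveOn⇒∣p∣≤∣q∣ {f = f} (inside ∷ p) {q} maps inj =
  ≤-trans (s≤s ∣p∣≤∣q-f0∣) (x∈p⇒∣p-x∣<∣p∣ (maps here))
  where
  ∣p∣≤∣q-f0∣ : ∣ p ∣ ≤ ∣ q - f zero ∣
  ∣p∣≤∣q-f0∣ = injectiveOn⇒∣p∣≤∣q∣ p
    (λ x∈p → x∈p∧x≢y⇒x∈p-y (maps (there x∈p))
      (λ eq → 0≢1+n (inj here (there x∈p) (sym eq))))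
    (λ x∈p y∈p eq → suc-injective (inj (there x∈p) (there y∈p) eq))

lookup-△ : ∀ {m} (p q : Subset m) x → lookup (p △ q) x ≡ lookup p x xor lookup q x
lookup-△ p q x = lookup-zipWith _xor_ x p q

lookup≡does-∈? : ∀ {m} (p : Subset m) x → lookup p x ≡ does (x ∈? p)
lookup≡does-∈? (inside ∷ p)  zero    = refl
lookup≡does-∈? (outside ∷ p) zero    = refl
lookup≡does-∈? (_ ∷ p)       (suc x) = lookup≡does-∈? p x

lookup-image : ∀ {m k} (f : Fin m → Fin k) (p : Subset m) x →
  (∀ {e} → e ∈ p → f e ≡ f x → e ≡ x) → lookup (image f p) (f x) ≡ lookup p x
lookup-image f p x inj = begin
  lookup (image f p) (f x)
    ≡⟨ lookup∘tabulate _ (f x) ⟩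
  does (any? λ e → (e ∈? p) ×-dec (f e ≟ f x))
    ≡⟨ does-⇔ preimage⇔∈ (any? λ e → (e ∈? p) ×-dec (f e ≟ f x)) (x ∈? p) ⟩
  does (x ∈? p)
    ≡⟨ sym (lookup≡does-∈? p x) ⟩
  lookup p x ∎
  where
  open ≡-Reasoning
  preimage⇔∈ : (∃ λ e → e ∈ p × f e ≡ f x) ⇔ x ∈ p
  preimage⇔∈ = mk⇔ (λ { (e , e∈p , eq) → subst (_∈ p) (inj e∈p eq) e∈p })
                   (λ x∈p → x , x∈p , refl)

xor≡true⇒∨≡true : ∀ a b → a xor b ≡ true → a ∨ b ≡ true
xor≡true⇒∨≡true true  _ _  = refl
xor≡true⇒∨≡true false b eq = eq

p△q⊆p∪q : ∀ {m} (p q : Subset m) → p △ q ⊆ p ∪ q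
p△q⊆p∪q p q {x} x∈p△q = lookup⇒[]= x (p ∪ q) (trans (lookup-zipWith _∨_ x p q)
  (xor≡true⇒∨≡true (lookup p x) (lookup q x)
    (trans (sym (lookup-△ p q x)) ([]=⇒lookup x∈p△q))))

△-cancelˡ : ∀ {m} (p q r : Subset m) → (p △ q) △ (p △ r) ≡ q △ r
△-cancelˡ []            []      []      = refl
△-cancelˡ (outside ∷ p) (a ∷ q) (b ∷ r) = cong ((a xor b) ∷_) (△-cancelˡ p q r)
△-cancelˡ (inside ∷ p)  (a ∷ q) (b ∷ r) = cong₂ _∷_ (xor-annihilates-not a b) (△-cancelˡ p q r)

∣p△q∣≤∣image-p△image-q∣ : ∀ {m k} (f : Fin m → Fin k) (p q : Subset m) →
  InjectiveOn f (p ∪ q) → ∣ p △ q ∣ ≤ ∣ image f p △ image f q ∣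
∣p△q∣≤∣image-p△image-q∣ f p q inj =
  injectiveOn⇒∣p∣≤∣q∣ (p △ q) f-maps (injectiveOn-⊆ (p△q⊆p∪q p q) inj)
  where
  open ≡-Reasoning
  f-maps : ∀ {x} → x ∈ p △ q → f x ∈ image f p △ image f q
  f-maps {x} x∈p△q = lookup⇒[]= (f x) _ (begin
    lookup (image f p △ image f q) (f x)          ≡⟨ lookup-△ (image f p) (image f q) (f x) ⟩
    lookup (image f p) (f x) xor lookup (image f q) (f x)
      ≡⟨ cong₂ _xor_ (lookup-image f p x (λ e∈p → inj (p⊆p∪q q e∈p) x∈p∪q))
                     (lookup-image f q x (λ e∈q → inj (q⊆p∪q p q e∈q) x∈p∪q)) ⟩
    lookup p x xor lookup q x                     ≡⟨ sym (lookup-△ p q x) ⟩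
    lookup (p △ q) x                              ≡⟨ []=⇒lookup x∈p△q ⟩
    true ∎)
    where
    x∈p∪q : x ∈ p ∪ q
    x∈p∪q = p△q⊆p∪q p q x∈p△q

lemma14 : (D : Digraph) → Acyclic D → (s t : Fin (nV D)) → (d q r : ℕ) →
    (P : ArcSet D) → IsPath D s t P →
    (Ps : Fin r → ArcSet D) → (∀ i → IsPath D s t (Ps i)) →
    (∀ i → ∣ P △ Ps i ∣ ≤ q) →
    (∀ i j → i < j → d ≤ ∣ Ps i △ Ps j ∣) →
    (f : Fin (nA D) → Fin (q * r)) →
    (∀ e e' → (∃ λ i → e ∈ (P △ Ps i)) → (∃ λ j → e' ∈ (P △ Ps j)) →
      e ≢ e' → f e ≢ f e') →
    ∀ i j → i < j → d ≤ ∣ image f (P △ Ps i) △ image f (P △ Ps j) ∣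
lemma14 D _ s t d q r P _ Ps _ _ dist f f-inj i j i<j = begin
  d                   ≤⟨ dist i j i<j ⟩
  ∣ Ps i △ Ps j ∣     ≡⟨ cong ∣_∣ (△-cancelˡ P (Ps i) (Ps j)) ⟨
  ∣ Bᵢ △ Bⱼ ∣         ≤⟨ ∣p△q∣≤∣image-p△image-q∣ f Bᵢ Bⱼ f-injectiveOn ⟩
  ∣ image f Bᵢ △ image f Bⱼ ∣ ∎
  where
  open ≤-Reasoning
  Bᵢ Bⱼ : ArcSet D
  Bᵢ = P △ Ps i
  Bⱼ = P △ Ps j

  in-some-B : ∀ {e} → e ∈ Bᵢ ∪ Bⱼ → ∃ λ k → e ∈ P △ Ps k
  in-some-B e∈ = [ (i ,_) , (j ,_) ]′ (x∈p∪q⁻ Bᵢ Bⱼ e∈)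

  f-injectiveOn : InjectiveOn f (Bᵢ ∪ Bⱼ)
  f-injectiveOn {e} {e'} e∈ e'∈ fe≡fe' = decidable-stable (e ≟ e')
    (λ e≢e' → f-inj e e' (in-some-B e∈) (in-some-B e'∈) e≢e' fe≡fe')
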